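{- Let $P$ be a message-transmission protocol with associated set of global states $S_P$, let $\mathcal{M}$ be the set of all messages that could be sent, and for $m\in\mathcal{M}$ let $G(m)\subseteq S_P$ be the set of global states where agent $1$ sends message $m$ to agent $2$. Then $P$ preserves message secrecy, i.e. for all $s\in S_P$ and all $m\in\mathcal{M}$ we have $\mathcal{K}^{dy}(s)\cap G(m)\neq\emptyset$, if and only if for every interpretation $\pi$ and every formula $\phi$: if $\phi$ depends only on the message exchanged by $P$ and $\phi$ is nontrivial in $M=(S_P,\mathcal{K}^{dy},\pi)$, then $M\models\neg K\phi$.
   Context: Epistemic logic: fix a set $\Phi_0$ of primitive propositions; formulas are built from $\Phi_0$ by $\neg$, $\wedge$ and $K$ ("the adversary knows"). An epistemic structure is $M=(W,\mathcal{K},\pi)$ with $W$ a set of worlds, $\mathcal{K}\subseteq W\times W$, $\mathcal{K}(w)=\{w'\mid (w,w')\in\mathcal{K}\}$, and $\pi$ (an interpretation) assigning to each world the set of primitive propositions true there. Truth: $(M,w)\models p$ iff $p\in\pi(w)$; $(M,w)\models\neg\phi$ iff not $(M,w)\models\phi$; $(M,w)\models\phi\wedge\psi$ iff both hold; $(M,w)\models K\phi$ iff $(M,w')\models\phi$ for all $w'\in\mathcal{K}(w)$. $M\models\phi$ means $(M,w)\models\phi$ for all $w\in W$. A formula $\phi$ is nontrivial in $M$ if there are $s,s'$ with $(M,s)\models\phi$ and $(M,s')\models\neg\phi$. Setting: global states are tuples $(s_e,s_{adv},s_1,\dots,s_n)$ of local states of the environment, the adversary and agents $1,\dots,n$. A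 message-transmission protocol is one whose goal is for agent $1$ to send a message confidentially to agent $2$; the adversary can intercept, forward and inject messages. $S_P$ is the set of global states the protocol goes through on execution (including those resulting from adversary actions), and includes states for all possible messages that could be sent. The adversary's local state $s_{adv}$ is a set of messages (intercepted messages plus initial messages such as public keys). Messages are symbolic: built from plaintexts $p$ and keys $k$ by pairing $(m_1,m_2)$ and encryption $\{m\}_k$; $k^{ -1}$ denotes the inverse (decryption) key of $k$. The relation $H\vdash m$ (for a set $H$ of messages) is the least relation closed under: $m\in H$ implies $H\vdash m$; $H\vdash\{m\}_k$ and $H\vdash k^{ -1}$ imply $H\vdash m$; $H\vdash(m_1,m_2)$ implies $H\vdash m_1$ and $H\vdash m_2$. For a set of keys $K$ define $\lfloor p\rfloor_K=p$, $\lfloor k\rfloor_K=k$, $\lfloor(m_1,m_2)\rfloor_K=(\lfloor m_1\rfloor_K,\lfloor m_2\rfloor_K)$, $\lfloor\{m\}_k\rfloor_K=\{\lfloor m\rfloor_K\}_k$ if $k^{ -1}\in K$ and $=\square$ (a fixed blank symbol) otherwise; $\lfloor H\rfloor_K=\{\lfloor m\rfloor_K\mid m\in H\}$. Let $\mathrm{Keys}(H)=\{k\mid H\vdash k\}$. The relation $\mathcal{K}^{dy}$ on $S_P$: $(s,s')\in\mathcal{K}^{dy}$ iff $\lfloor s_{adv}\rfloor_{\mathrm{Keys}(s_{adv})}=\lfloor s'_{adv}\rfloor_{\mathrm{Keys}(s'_{adv})}$. A formula $\phi$ depends only on the message exchanged by the protocol (in $M$) if $(M,s)\models\phi$ iff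 $(M,s')\models\phi$ whenever the same message is exchanged in states $s$ and $s'$. -}

module Defs where

open import Data.Product using (Σ; ∃; _×_; _,_)
open import Data.Empty using (⊥)
open import Relation.Nullary using (¬_)
open import Relation.Binary.PropositionalEquality using (_≡_)
open import Function.Bundles using (_⇔_)

data Msg (Plain Key : Set) : Set where
  plain : Plain → Msg Plain Key
  key   : Key → Msg Plain Key
  pair  : Msg Plain Key → Msg Plain Key → Msg Plain Key
  enc   : Msg Plain Key → Key → Msg Plain Key

-- Blinded messages (messages possibly containing the blank symbol □)
data Pat (Plain Key : Set) : Set where
  plain : Plain → Pat Plain Key
  key   : Key → Pat Plain Key
  pair  : Pat Plain Key → Pat Plain Key → Pat Plain Key
  enc   : Pat Plain Key → Key → Pat Plain Key
  □     : Pat Plain Key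

MsgSet : Set → Set → Set₁
MsgSet Plain Key = Msg Plain Key → Set

module Symbolic {Plain Key : Set} (inv : Key → Key) where

  data _⊢_ (H : MsgSet Plain Key) : Msg Plain Key → Set where
    ax   : ∀ {m} → H m → H ⊢ m
    dec  : ∀ {m k} → H ⊢ enc m k → H ⊢ key (inv k) → H ⊢ m
    fst  : ∀ {m₁ m₂} → H ⊢ pair m₁ m₂ → H ⊢ m₁
    snd  : ∀ {m₁ m₂} → H ⊢ pair m₁ m₂ → H ⊢ m₂

  Keys : MsgSet Plain Key → Key → Set
  Keys H k = H ⊢ key k

  -- Graph of the blinding function: Blind K m r  iff  ⌊ m ⌋_K = r
  data Blind (K : Key → Set) : Msg Plain Key → Pat Plain Key → Set where
    plain   : ∀ p → Blind K (plain p) (plain p)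
    key     : ∀ k → Blind K (key k) (key k)
    pair    : ∀ {m₁ m₂ r₁ r₂} → Blind K m₁ r₁ → Blind K m₂ r₂ →
              Blind K (pair m₁ m₂) (pair r₁ r₂)
    enc-yes : ∀ {m r k} → K (inv k) → Blind K m r → Blind K (enc m k) (enc r k)
    enc-no  : ∀ {m k} → ¬ K (inv k) → Blind K (enc m k) □

  BlindSet : (Key → Set) → MsgSet Plain Key → Pat Plain Key → Set
  BlindSet K H r = ∃ λ m → H m × Blind K m r

  -- 𝒦^dy on adversary local states:
  -- ⌊ H ⌋_{Keys(H)} = ⌊ H' ⌋_{Keys(H')}  (equality of sets)
  KdyAdv : MsgSet Plain Key → MsgSet Plain Key → Set
  KdyAdv H H' = ∀ r → BlindSet (Keys H) H r ⇔ BlindSet (Keys H') H' r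

record Protocol (Plain Key : Set) : Set₁ where
  field
    GState   : Set
    Message  : Set
    advState : GState → MsgSet Plain Key
    sent     : GState → Message
    allMessages : ∀ m → ∃ λ s → sent s ≡ m

  G : Message → GState → Set
  G m s = sent s ≡ m

data Formula (Φ₀ : Set) : Set where
  prim : Φ₀ → Formula Φ₀
  ¬'_  : Formula Φ₀ → Formula Φ₀
  _∧'_ : Formula Φ₀ → Formula Φ₀ → Formula Φ₀
  K    : Formula Φ₀ → Formula Φ₀

record Structure (Φ₀ : Set) : Set₁ where
  field
    W  : Set
    𝒦  : W → W → Set
    π  : W → Φ₀ → Set

module _ {Φ₀ : Set} (M : Structure Φ₀) where
  open Structure M

  _⊨_ : W → Formula Φ₀ → Set
  w ⊨ prim p    = π w p
  w ⊨ (¬' φ)    = ¬ (w ⊨ φ)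
  w ⊨ (φ ∧' ψ)  = (w ⊨ φ) × (w ⊨ ψ)
  w ⊨ K φ       = ∀ w' → 𝒦 w w' → w' ⊨ φ

  Valid : Formula Φ₀ → Set
  Valid φ = ∀ w → w ⊨ φ

  Nontrivial : Formula Φ₀ → Set
  Nontrivial φ = Σ W λ s → Σ W λ s' → (s ⊨ φ) × (s' ⊨ (¬' φ))

_∩_ : {A : Set} → (A → Set) → (A → Set) → A → Set
(P ∩ Q) x = P x × Q x

IsEmpty : {A : Set} → (A → Set) → Set
IsEmpty P = ∀ x → ¬ P x

module _ {Plain Key : Set} (inv : Key → Key) (P : Protocol Plain Key) where
  open Protocol P
  open Symbolic {Plain} inv

  Kdy : GState → GState → Set
  Kdy s s' = KdyAdv (advState s) (advState s')

  Kdy[_] : GState → GState → Set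
  Kdy[ s ] s' = Kdy s s'

  PreservesSecrecy : Set
  PreservesSecrecy = ∀ s m → ¬ IsEmpty (Kdy[ s ] ∩ G m)

  model : {Φ₀ : Set} → (GState → Φ₀ → Set) → Structure Φ₀
  model π = record { W = GState ; 𝒦 = Kdy ; π = π }

  DependsOnlyOnMessage : {Φ₀ : Set} → (GState → Φ₀ → Set) → Formula Φ₀ → Set
  DependsOnlyOnMessage π φ =
    ∀ s s' → sent s ≡ sent s' → (_⊨_ (model π) s φ ⇔ _⊨_ (model π) s' φ)

-- If every 𝒦^dy(w) meets every G(m), then at any w the adversary considers possible some
-- state sending the same message as a state falsifying φ; when φ depends only on the
-- message, φ fails there, so K φ fails at w. Conversely, if 𝒦^dy(s) misses
-- G(m), interpret a proposition as "the message sent is not m": it depends only on the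
-- message, is nontrivial (true at s, since 𝒦^dy is reflexive, and false at any state
-- sending m), and is known at s.
module Submission where

open import Defs
open import Data.Product using (_,_)
open import Function.Bundles using (_⇔_; mk⇔; Equivalence)
open import Function.Construct.Identity using (⇔-id)
open import Relation.Nullary using (¬_)
open import Relation.Binary.PropositionalEquality using (sym; trans)

module _ {Plain Key : Set} (inv : Key → Key) (P : Protocol Plain Key) where
  open Protocol P

  Kdy-refl : ∀ s → Kdy inv P s s
  Kdy-refl s r = ⇔-id _

  secrecy⇒¬K : PreservesSecrecy inv P → ∀ {Φ₀} (π : GState → Φ₀ → Set) φ →
               DependsOnlyOnMessage inv P π φ →
               ∀ s' → _⊨_ (model inv P π) s' (¬' φ) → Valid (model inv P π) (¬' K φ)
  secrecy⇒¬K secret π φ depends s' s'⊭φ w w⊨Kφ =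
    secret w (sent s') λ where
      t (w𝒦t , sent-t) → s'⊭φ (Equivalence.to (depends t s' sent-t) (w⊨Kφ t w𝒦t))

  NotSending : {Φ₀ : Set} → Message → GState → Φ₀ → Set
  NotSending m s _ = ¬ G m s

  module _ {Φ₀ : Set} (p₀ : Φ₀) (m : Message) where
    private
      π : GState → Φ₀ → Set
      π = NotSending m

      M : Structure Φ₀
      M = model inv P π

    notSending-dependsOnlyOnMessage : DependsOnlyOnMessage inv P π (prim p₀)
    notSending-dependsOnlyOnMessage s s' same =
      mk⇔ (λ ¬Gs Gs' → ¬Gs (trans same Gs')) (λ ¬Gs' Gs → ¬Gs' (trans (sym same) Gs))

    module _ {s : GState} (hidden : IsEmpty (Kdy[_] inv P s ∩ G m)) where

      notSending-known : _⊨_ M s (K (prim p₀))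
      notSending-known t s𝒦t Gt = hidden t (s𝒦t , Gt)

      notSending-nontrivial : Nontrivial M (prim p₀)
      notSending-nontrivial with allMessages m
      ... | t , Gt = s , t , (λ Gs → hidden s (Kdy-refl s , Gs)) , (λ ¬Gt → ¬Gt Gt)

theorem2 : {Plain Key Φ₀ : Set} (inv : Key → Key) (p₀ : Φ₀)
    (P : Protocol Plain Key) →
    PreservesSecrecy inv P
    ⇔ (∀ (π : Protocol.GState P → Φ₀ → Set) (φ : Formula Φ₀) →
    DependsOnlyOnMessage inv P π φ →
    Nontrivial (model inv P π) φ →
    Valid (model inv P π) (¬' K φ))
theorem2 inv p₀ P = mk⇔
  (λ secret π φ depends (_ , s' , _ , s'⊭φ) → secrecy⇒¬K inv P secret π φ depends s' s'⊭φ)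
  (λ ¬K s m hidden →
    ¬K (NotSending inv P m) (prim p₀)
       (notSending-dependsOnlyOnMessage inv P p₀ m)
       (notSending-nontrivial inv P p₀ m hidden)
       s (notSending-known inv P p₀ m hidden))
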